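{- Let $\lambda$ and $\mu$ be partitions of $m$. If standard tableaux $Q$ and $Q'$ on $\lambda$ satisfy $\nu_\mu\circ Q=\nu_\mu\circ Q'$, then $Y_\mu\Delta_Q=Y_\mu\Delta_{Q'}$.
   Context: $S_m$ acts on $\mathbb{C}[x_1,\ldots,x_m]$ by $\sigma x_i=x_{\sigma(i)}$. A standard tableau $Q$ on $\lambda$ is a bijection from the boxes of the Young diagram of $\lambda$ to $\{1,\ldots,m\}$ increasing along rows and down columns; its Specht polynomial is $\Delta_Q=\prod_{\text{columns }c}\prod_{i<i'}(x_{Q_{i,c}}-x_{Q_{i',c}})$. $t_\mu$ is the numbering of the diagram of $\mu$ by $1,\ldots,m$ left to right along rows, top row first; $\nu_\mu:\{1,\ldots,m\}\to\mathbb{N}$ sends $i$ to the index of the row of $t_\mu$ containing $i$. $S_\mu=S_{\{1,\ldots,\mu_1\}}\times S_{\{\mu_1+1,\ldots,\mu_1+\mu_2\}}\times\cdots$ and $Y_\mu=\frac1{|S_\mu|}\sum_{\sigma\in S_\mu}\sigma\in\mathbb{C}[S_m]$. -}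

module Defs where

open import Data.Nat using (ℕ; zero; suc; _∸_; _<_; _≤_; _<ᵇ_; _≡ᵇ_; NonZero)
open import Data.Bool using (Bool; true; false; if_then_else_; _∧_; _∨_; not)
open import Data.Fin using (Fin; toℕ) renaming (_≟_ to _≟F_)
open import Data.List using (List; []; _∷_; map; foldr; concatMap; upTo; allFin; length; filterᵇ)
open import Data.Bool.ListAction using (and)
open import Data.Nat.ListAction using (sum)
import Data.Fin
open import Data.List.Relation.Unary.All using (All)
open import Data.List.Relation.Unary.Linked using (Linked)
open import Data.Vec.Functional using (Vector) renaming (_∷_ to _∷ᵛ_)
open import Data.Rational using (ℚ; 0ℚ; 1ℚ; _+_; _*_; _-_; _/_)
open import Data.Integer using (+_)
open import Relation.Nullary.Decidable using (isYes)
open import Relation.Binary.PropositionalEquality using (_≡_)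
open import Data.Product using (_×_; Σ)

IsPartition : ℕ → List ℕ → Set
IsPartition m λ′ = All (λ k → 0 < k) λ′ × Linked (λ a b → b ≤ a) λ′ × sum λ′ ≡ m

part : List ℕ → ℕ → ℕ
part []       _       = 0
part (a ∷ as) zero    = a
part (a ∷ as) (suc r) = part as r

-- (r , c) is a box of the Young diagram (0-indexed row r, column c)
InDiagram : List ℕ → ℕ → ℕ → Set
InDiagram λ′ r c = c < part λ′ r

-- ν_μ : index of the row of t_μ containing the entry i (entries and rows 0-indexed)
rowOf : List ℕ → ℕ → ℕ
rowOf []       i = 0
rowOf (a ∷ as) i = if i <ᵇ a then 0 else suc (rowOf as (i ∸ a))

ν : List ℕ → {m : ℕ} → Fin m → ℕ
ν μ i = rowOf μ (toℕ i)

-- Standard tableaux on λ with entries in Fin m (entries 0,…,m-1).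
-- Q r c is the entry of box (r,c); values outside the diagram are irrelevant.

record StandardTableau (m : ℕ) (λ′ : List ℕ) : Set where
  field
    Q          : ℕ → ℕ → Fin m
    injective  : ∀ r c r′ c′ → InDiagram λ′ r c → InDiagram λ′ r′ c′ →
                 Q r c ≡ Q r′ c′ → (r ≡ r′) × (c ≡ c′)
    surjective : ∀ (k : Fin m) → Σ ℕ (λ r → Σ ℕ (λ c → InDiagram λ′ r c × Q r c ≡ k))
    rowIncr    : ∀ r c c′ → InDiagram λ′ r c′ → c < c′ → toℕ (Q r c) < toℕ (Q r c′)
    colIncr    : ∀ r r′ c → InDiagram λ′ r′ c → r < r′ → toℕ (Q r c) < toℕ (Q r′ c)

-- Polynomials in x_0,…,x_{m-1} with rational coefficients, given by their
-- coefficient function on exponent vectors α : Fin m → ℕ.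

Mon : ℕ → Set
Mon m = Fin m → ℕ

Poly : ℕ → Set
Poly m = Mon m → ℚ

allᵇ : {A : Set} → (A → Bool) → List A → Bool
allᵇ p xs = and (map p xs)

sumℚ : List ℚ → ℚ
sumℚ = foldr _+_ 0ℚ

-- all exponent vectors β with β ≤ α componentwise
below : (m : ℕ) → Mon m → List (Mon m)
below zero    α = (λ ()) ∷ []
below (suc m) α =
  concatMap (λ k → map (λ β → k ∷ᵛ β) (below m (λ i → α (Data.Fin.suc i)))) (upTo (suc (α Data.Fin.zero)))

_⊕_ : ∀ {m} → Poly m → Poly m → Poly m
(p ⊕ q) α = p α + q α

_⊖_ : ∀ {m} → Poly m → Poly m → Poly m
(p ⊖ q) α = p α - q α

_⊗_ : ∀ {m} → Poly m → Poly m → Poly m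
_⊗_ {m} p q α = sumℚ (map (λ β → p β * q (λ i → α i ∸ β i)) (below m α))

isZeroMon : ∀ {m} → Mon m → Bool
isZeroMon {m} α = allᵇ (λ i → α i ≡ᵇ 0) (allFin m)

isUnitMon : ∀ {m} → Fin m → Mon m → Bool
isUnitMon {m} j α = allᵇ (λ i → α i ≡ᵇ (if isYes (i ≟F j) then 1 else 0)) (allFin m)

one : ∀ {m} → Poly m
one α = if isZeroMon α then 1ℚ else 0ℚ

var : ∀ {m} → Fin m → Poly m
var j α = if isUnitMon j α then 1ℚ else 0ℚ

prodPoly : ∀ {m} → List (Poly m) → Poly m
prodPoly = foldr _⊗_ one

sumPoly : ∀ {m} → List (Poly m) → Poly m
sumPoly = foldr _⊕_ (λ _ → 0ℚ)

scale : ∀ {m} → ℚ → Poly m → Poly m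
scale a p α = a * p α

-- action of a permutation σ : σ x_i = x_{σ i}, so σ(x^α) = x^β with β ∘ σ = α;
-- hence coeff_β (σ p) = coeff_{β∘σ} p.
act : ∀ {m} → (Fin m → Fin m) → Poly m → Poly m
act σ p β = p (λ i → β (σ i))

-- Specht polynomial
-- Δ_Q = ∏_{columns c} ∏_{i < i' in column c} (x_{Q i c} − x_{Q i' c})

specht : ∀ {m} (λ′ : List ℕ) → StandardTableau m λ′ → Poly m
specht λ′ T =
  prodPoly (concatMap (λ c → concatMap (λ i′ → map (λ i →
      if c <ᵇ part λ′ i′ then (var (Q i c) ⊖ var (Q i′ c)) else one)
    (upTo i′)) (upTo (length λ′))) (upTo (part λ′ 0)))
  where open StandardTableau T

allFuns : (k n : ℕ) → List (Fin k → Fin n)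
allFuns zero    n = (λ ()) ∷ []
allFuns (suc k) n = concatMap (λ a → map (λ f → a ∷ᵛ f) (allFuns k n)) (allFin n)

-- σ is injective (hence a permutation of Fin m) and preserves the rows of t_μ
inYoung : ∀ {m} → List ℕ → (Fin m → Fin m) → Bool
inYoung {m} μ σ =
  allᵇ (λ i → allᵇ (λ j → not (isYes (σ i ≟F σ j)) ∨ isYes (i ≟F j)) (allFin m)) (allFin m)
  ∧ allᵇ (λ i → ν μ (σ i) ≡ᵇ ν μ i) (allFin m)

youngSubgroup : (m : ℕ) → List ℕ → List (Fin m → Fin m)
youngSubgroup m μ = filterᵇ (inYoung μ) (allFuns m m)

-- 1/n for n ≥ 1 (n = |S_μ| ≥ 1 always, as the identity lies in S_μ)
inv : ℕ → ℚ
inv zero    = 0ℚ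
inv (suc n) = + 1 / suc n

Y : ∀ {m} → List ℕ → Poly m → Poly m
Y {m} μ p = scale (inv (length (youngSubgroup m μ))) (sumPoly (map (λ σ → act σ p) (youngSubgroup m μ)))

-- Let τ be the permutation of the entries sending Q's entry in each box to Q′'s entry in
-- the same box. It maps every factor x_{Q i c} − x_{Q i′ c} of Δ_Q to the corresponding
-- factor of Δ_{Q′}, so Δ_{Q′} = τ Δ_Q. The hypothesis ν_μ ∘ Q = ν_μ ∘ Q′ says that τ
-- preserves the rows of t_μ, i.e. τ ∈ S_μ; as σ ↦ σ τ permutes S_μ, Y_μ τ = Y_μ, and
-- therefore Y_μ Δ_{Q′} = Y_μ τ Δ_Q = Y_μ Δ_Q.
module Submission where

open import Defs
open import Level using (Level)
open import Function using (id; _∘_; _⇔_; mk⇔; Equivalence)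
open import Function.Definitions using (Injective)
open import Data.Bool using (Bool; true; false; T; not; _∨_; if_then_else_)
open import Data.Bool.Properties using (T-∧)
open import Data.Bool.ListAction using (and)
open import Data.Unit using (tt)
open import Data.Product using (_×_; _,_; proj₁; proj₂)
open import Data.Nat using (ℕ; zero; suc; _≤_; _<_; z≤n; s≤s; s≤s⁻¹; _∸_; _≡ᵇ_; _<ᵇ_)
open import Data.Nat.Properties using (≤-refl; ≤-trans; <-≤-trans; <⇒≤; <ᵇ-reflects-<; ≡ᵇ⇒≡; ≡⇒≡ᵇ)
open import Data.Fin using (Fin; zero; suc) renaming (_≟_ to _≟ᶠ_)
open import Data.Fin.Permutation
  using (Permutation′; permutation; flip; _⟨$⟩ʳ_; _⟨$⟩ˡ_; inverseˡ; inverseʳ)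
open import Data.Rational using (ℚ; 0ℚ; 1ℚ; _+_; _*_; _-_)
open import Data.Rational.Properties using (+-0-isCommutativeMonoid)
open import Data.Vec.Functional using (Vector; head; tail) renaming (_∷_ to _∷ᵛ_)
open import Data.Vec.Functional.Properties using (∷-cong; ∷-injective)
open import Data.List
  using (List; []; _∷_; _++_; map; concatMap; cartesianProductWith; upTo; allFin; length)
open import Data.List.Properties using (map-∘; map-cong)
open import Data.List.Membership.Propositional using (_∈_)
import Data.List.Membership.Propositional.Properties as ∈ₚ
import Data.List.Membership.Setoid as SetoidMembership
import Data.List.Membership.Setoid.Properties as SetoidMembershipₚ
open import Data.List.Relation.Unary.Any using (here; there)
open import Data.List.Relation.Unary.All as All using (All; [])
import Data.List.Relation.Unary.All.Properties as Allₚ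
open import Data.List.Relation.Unary.AllPairs using ([]; _∷_) renaming (tail to uniqueTail)
open import Data.List.Relation.Unary.Unique.Propositional using (Unique)
import Data.List.Relation.Unary.Unique.Propositional.Properties as Uniqueₚ
import Data.List.Relation.Unary.Unique.Setoid as SetoidUnique
import Data.List.Relation.Unary.Unique.Setoid.Properties as SetoidUniqueₚ
import Data.List.Relation.Binary.Permutation.Setoid as SetoidPermutation
import Data.List.Relation.Binary.Permutation.Setoid.Properties as SetoidPermutationₚ
open import Data.List.Relation.Binary.Pointwise as Pointwise using (Pointwise; []; _∷_)
open import Data.List.Relation.Unary.Linked using (Linked; _∷_)
open import Relation.Binary.Bundles using (Setoid)
open import Relation.Binary.Core using (_Preserves_⟶_)
open import Relation.Binary.Definitions using (_Respects_)
open import Relation.Binary.PropositionalEquality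
  using (_≡_; _≗_; refl; sym; trans; cong; cong₂; subst; setoid; _→-setoid_; module ≡-Reasoning)
open import Relation.Nullary using (contradiction)
open import Relation.Nullary.Decidable using (Dec; yes; no; does-⇔; T?; isYes)
open import Relation.Nullary.Reflects using (ofʸ)

module _ {A B : Set} where
  open SetoidMembership (A →-setoid B) public using () renaming (_∈_ to _∈≗_)
  open SetoidUnique (A →-setoid B) public using () renaming (Unique to Unique≗)

module _ {a ℓ : Level} (S : Setoid a ℓ) where
  open Setoid S using (Carrier; _≈_) renaming (refl to ≈-refl; sym to ≈-sym; trans to ≈-trans)
  open SetoidMembership S using () renaming (_∈_ to _∈ₛ_)
  open SetoidMembershipₚ using (∈-resp-≈; ∈-∃++)
  open SetoidUnique S using () renaming (Unique to Uniqueₛ)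
  open SetoidPermutation S using (_↭_; prep; ↭-refl; ↭-sym; ↭-trans; ↭-reflexive-≋)
  open SetoidPermutationₚ S using (shift; ∈-resp-↭; Unique-resp-↭)

  unique-⊆-⊇⇒↭ : ∀ {xs ys} → Uniqueₛ xs → Uniqueₛ ys →
                 (∀ {z} → z ∈ₛ xs → z ∈ₛ ys) → (∀ {z} → z ∈ₛ ys → z ∈ₛ xs) → xs ↭ ys
  unique-⊆-⊇⇒↭ {[]}     {[]}    _ _ _ _   = ↭-refl
  unique-⊆-⊇⇒↭ {[]}     {_ ∷ _} _ _ _ ys⊆ = contradiction (ys⊆ (here ≈-refl)) λ ()
  unique-⊆-⊇⇒↭ {x ∷ xs} {ys} x∷xs! ys! xs⊆ ys⊆
    with as , bs , w , x≈w , ys≋ ← ∈-∃++ S (xs⊆ (here ≈-refl)) =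
    ↭-trans (prep x≈w (unique-⊆-⊇⇒↭ (uniqueTail x∷xs!) (uniqueTail w∷rest!) xs⊆rest rest⊆xs))
            (↭-sym ys↭w∷rest)
    where
    rest = as ++ bs
    ys↭w∷rest : ys ↭ w ∷ rest
    ys↭w∷rest = ↭-trans (↭-reflexive-≋ ys≋) (shift ≈-refl as bs)
    w∷rest! : Uniqueₛ (w ∷ rest)
    w∷rest! = Unique-resp-↭ ys↭w∷rest ys!
    xs⊆rest : ∀ {z} → z ∈ₛ xs → z ∈ₛ rest
    xs⊆rest z∈xs with ∈-resp-↭ ys↭w∷rest (xs⊆ (there z∈xs))
    ... | here z≈w     = contradiction (∈-resp-≈ S (≈-trans z≈w (≈-sym x≈w)) z∈xs)
                                       (SetoidUniqueₚ.Unique[x∷xs]⇒x∉xs S x∷xs!)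
    ... | there z∈rest = z∈rest
    rest⊆xs : ∀ {z} → z ∈ₛ rest → z ∈ₛ xs
    rest⊆xs z∈rest with ys⊆ (∈-resp-↭ (↭-sym ys↭w∷rest) (there z∈rest))
    ... | here z≈x   = contradiction (∈-resp-≈ S (≈-trans z≈x x≈w) z∈rest)
                                     (SetoidUniqueₚ.Unique[x∷xs]⇒x∉xs S w∷rest!)
    ... | there z∈xs = z∈xs

  sumℚ-reindex : ∀ {f : Carrier → ℚ} → f Preserves _≈_ ⟶ _≡_ →
                 ∀ {xs ys} → Uniqueₛ xs → Uniqueₛ ys →
                 (∀ {z} → z ∈ₛ xs → z ∈ₛ ys) → (∀ {z} → z ∈ₛ ys → z ∈ₛ xs) →
                 sumℚ (map f xs) ≡ sumℚ (map f ys)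
  sumℚ-reindex f-cong xs! ys! xs⊆ ys⊆ =
    SetoidPermutationₚ.foldr-commMonoid (setoid ℚ) +-0-isCommutativeMonoid
      (SetoidPermutationₚ.map⁺ S (setoid ℚ) f-cong (unique-⊆-⊇⇒↭ xs! ys! xs⊆ ys⊆))

module _ {B : Set} {m : ℕ} (π : Permutation′ m) where

  sumℚ-precompose : ∀ {F : (Fin m → B) → ℚ} → F Preserves _≗_ ⟶ _≡_ →
                    ∀ {xs ys} → Unique≗ xs → Unique≗ ys →
                    (∀ {f} → f ∈≗ xs → f ∘ (π ⟨$⟩ʳ_) ∈≗ ys) →
                    (∀ {g} → g ∈≗ ys → g ∘ (π ⟨$⟩ˡ_) ∈≗ xs) →
                    sumℚ (map (λ f → F (f ∘ (π ⟨$⟩ʳ_))) xs) ≡ sumℚ (map F ys)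
  sumℚ-precompose {F} F-cong {xs} {ys} xs! ys! xs→ys ys→xs = begin
    sumℚ (map (F ∘ _∘π) xs)    ≡⟨ cong sumℚ (map-∘ xs) ⟩
    sumℚ (map F (map _∘π xs))  ≡⟨ sumℚ-reindex S F-cong
                                    (SetoidUniqueₚ.map⁺ S S ∘π-injective xs!) ys! ⊆ys ys⊆ ⟩
    sumℚ (map F ys)            ∎
    where
    open ≡-Reasoning
    S = Fin m →-setoid B
    _∘π : (Fin m → B) → (Fin m → B)
    f ∘π = f ∘ (π ⟨$⟩ʳ_)
    ∘π-injective : ∀ {f g} → f ∘π ≗ g ∘π → f ≗ g
    ∘π-injective {f} {g} eq i = begin
      f i                   ≡⟨ cong f (inverseʳ π) ⟨
      f (π ⟨$⟩ʳ (π ⟨$⟩ˡ i))  ≡⟨ eq (π ⟨$⟩ˡ i) ⟩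
      g (π ⟨$⟩ʳ (π ⟨$⟩ˡ i))  ≡⟨ cong g (inverseʳ π) ⟩
      g i                   ∎
    ⊆ys : ∀ {h} → h ∈≗ map _∘π xs → h ∈≗ ys
    ⊆ys h∈ with f , f∈xs , h≗f∘π ← SetoidMembershipₚ.∈-map⁻ S S h∈ =
      SetoidMembershipₚ.∈-resp-≈ S (λ i → sym (h≗f∘π i)) (xs→ys f∈xs)
    ys⊆ : ∀ {g} → g ∈≗ ys → g ∈≗ map _∘π xs
    ys⊆ {g} g∈ys = SetoidMembershipₚ.∈-resp-≈ S (λ i → cong g (inverseˡ π))
      (SetoidMembershipₚ.∈-map⁺ S S (λ eq i → eq (π ⟨$⟩ʳ i)) (ys→xs g∈ys))

concatMap-map≡cartesianProductWith : ∀ {A B C : Set} (f : A → B → C) xs ys →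
  concatMap (λ x → map (f x) ys) xs ≡ cartesianProductWith f xs ys
concatMap-map≡cartesianProductWith f []       ys = refl
concatMap-map≡cartesianProductWith f (x ∷ xs) ys =
  cong (map (f x) ys ++_) (concatMap-map≡cartesianProductWith f xs ys)

module _ {B : Set} {n : ℕ} where
  private
    Vecₛ : ℕ → Setoid _ _
    Vecₛ k = Fin k →-setoid B

  conses : List B → List (Vector B n) → List (Vector B (suc n))
  conses ks vs = concatMap (λ k → map (k ∷ᵛ_) vs) ks

  ∈-conses⁺ : ∀ {v ks vs} → head v ∈ ks → tail v ∈≗ vs → v ∈≗ conses ks vs
  ∈-conses⁺ {v} {ks} {vs} h∈ t∈ =
    subst (v ∈≗_) (sym (concatMap-map≡cartesianProductWith _∷ᵛ_ ks vs))
      (SetoidMembershipₚ.∈-resp-≈ (Vecₛ (suc n)) (∷-cong refl (λ _ → refl))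
        (SetoidMembershipₚ.∈-cartesianProductWith⁺ (setoid B) (Vecₛ n) (Vecₛ (suc n))
          (λ { refl t≗ → ∷-cong refl t≗ }) h∈ t∈))

  ∈-conses⁻ : ∀ {v} ks vs → v ∈≗ conses ks vs → head v ∈ ks × tail v ∈≗ vs
  ∈-conses⁻ {v} ks vs v∈
    with k , w , k∈ , w∈ , v≗k∷w ←
           SetoidMembershipₚ.∈-cartesianProductWith⁻ (setoid B) (Vecₛ n) (Vecₛ (suc n)) _∷ᵛ_ ks vs
             (subst (v ∈≗_) (concatMap-map≡cartesianProductWith _∷ᵛ_ ks vs) v∈)
    with refl , t≗ ← ∷-injective v≗k∷w =
    k∈ , SetoidMembershipₚ.∈-resp-≈ (Vecₛ n) (λ i → sym (t≗ i)) w∈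

  conses-unique : ∀ {ks vs} → Unique ks → Unique≗ vs → Unique≗ (conses ks vs)
  conses-unique {ks} {vs} ks! vs! =
    subst Unique≗ (sym (concatMap-map≡cartesianProductWith _∷ᵛ_ ks vs))
      (SetoidUniqueₚ.cartesianProductWith⁺ (setoid B) (Vecₛ n) (Vecₛ (suc n)) _∷ᵛ_ ∷-injective ks! vs!)

∈-below⁺ : ∀ m {α β : Mon m} → (∀ i → β i ≤ α i) → β ∈≗ below m α
∈-below⁺ zero    _   = here (λ ())
∈-below⁺ (suc m) β≤α = ∈-conses⁺ (∈ₚ.∈-upTo⁺ (s≤s (β≤α zero))) (∈-below⁺ m (β≤α ∘ suc))

∈-below⁻ : ∀ m {α β : Mon m} → β ∈≗ below m α → ∀ i → β i ≤ α i
∈-below⁻ (suc m) {α} β∈ zero    =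
  s≤s⁻¹ (∈ₚ.∈-upTo⁻ (proj₁ (∈-conses⁻ (upTo (suc (α zero))) (below m (tail α)) β∈)))
∈-below⁻ (suc m) {α} β∈ (suc i) =
  ∈-below⁻ m (proj₂ (∈-conses⁻ (upTo (suc (α zero))) (below m (tail α)) β∈)) i

below-unique : ∀ m (α : Mon m) → Unique≗ (below m α)
below-unique zero    α = [] ∷ []
below-unique (suc m) α = conses-unique (Uniqueₚ.upTo⁺ (suc (α zero))) (below-unique m (tail α))

∈-allFuns : ∀ k n (σ : Fin k → Fin n) → σ ∈≗ allFuns k n
∈-allFuns zero    n σ = here (λ ())
∈-allFuns (suc k) n σ = ∈-conses⁺ (∈ₚ.∈-allFin (head σ)) (∈-allFuns k n (tail σ))

allFuns-unique : ∀ k n → Unique≗ (allFuns k n)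
allFuns-unique zero    n = [] ∷ []
allFuns-unique (suc k) n = conses-unique (Uniqueₚ.allFin⁺ n) (allFuns-unique k n)

isYes-⇔ : ∀ {A B : Set} → A ⇔ B → (a? : Dec A) (b? : Dec B) → isYes a? ≡ isYes b?
isYes-⇔ A⇔B (yes _) (yes _) = refl
isYes-⇔ A⇔B (no _)  (no _)  = refl
isYes-⇔ A⇔B (yes a) (no ¬b) = contradiction (Equivalence.to A⇔B a) ¬b
isYes-⇔ A⇔B (no ¬a) (yes b) = contradiction (Equivalence.from A⇔B b) ¬a

T-implication : ∀ {P Q : Set} (P? : Dec P) (Q? : Dec Q) → T (not (isYes P?) ∨ isYes Q?) ⇔ (P → Q)
T-implication (yes _) (yes q) = mk⇔ (λ _ _ → q) (λ _ → tt)
T-implication (yes p) (no ¬q) = mk⇔ (λ ()) (λ p→q → ¬q (p→q p))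
T-implication (no ¬p) _       = mk⇔ (λ _ p → contradiction p ¬p) (λ _ → tt)

allᵇ-cong : ∀ {A : Set} {p q : A → Bool} → p ≗ q → ∀ xs → allᵇ p xs ≡ allᵇ q xs
allᵇ-cong p≗q xs = cong and (map-cong p≗q xs)

T-allᵇ : ∀ {A : Set} (p : A → Bool) xs → T (allᵇ p xs) ⇔ All (T ∘ p) xs
T-allᵇ p []       = mk⇔ (λ _ → []) (λ _ → tt)
T-allᵇ p (x ∷ xs) = mk⇔
  (λ t → let px , pxs = Equivalence.to T-∧ t in px All.∷ Equivalence.to (T-allᵇ p xs) pxs)
  (λ { (px All.∷ pxs) → Equivalence.from T-∧ (px , Equivalence.from (T-allᵇ p xs) pxs) })

T-allᵇ-allFin : ∀ {m} (p : Fin m → Bool) → T (allᵇ p (allFin m)) ⇔ (∀ i → T (p i))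
T-allᵇ-allFin {m} p = mk⇔ (Allₚ.tabulate⁻ ∘ Equivalence.to (T-allᵇ p (allFin m)))
                          (Equivalence.from (T-allᵇ p (allFin m)) ∘ Allₚ.tabulate⁺)

⟨$⟩ʳ-injective : ∀ {m} (π : Permutation′ m) → Injective _≡_ _≡_ (π ⟨$⟩ʳ_)
⟨$⟩ʳ-injective π {i} {j} eq = trans (sym (inverseˡ π)) (trans (cong (π ⟨$⟩ˡ_) eq) (inverseˡ π))

allᵇ-allFin-∘ : ∀ {m} (π : Permutation′ m) (p : Fin m → Bool) →
                allᵇ (p ∘ (π ⟨$⟩ʳ_)) (allFin m) ≡ allᵇ p (allFin m)
allᵇ-allFin-∘ {m} π p = does-⇔ (mk⇔ ⇒ ⇐) (T? _) (T? _)
  where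
  open Equivalence
  ⇒ : T (allᵇ (p ∘ (π ⟨$⟩ʳ_)) (allFin m)) → T (allᵇ p (allFin m))
  ⇒ t = from (T-allᵇ-allFin p) λ k →
    subst (T ∘ p) (inverseʳ π) (to (T-allᵇ-allFin (p ∘ (π ⟨$⟩ʳ_))) t (π ⟨$⟩ˡ k))
  ⇐ : T (allᵇ p (allFin m)) → T (allᵇ (p ∘ (π ⟨$⟩ʳ_)) (allFin m))
  ⇐ t = from (T-allᵇ-allFin (p ∘ (π ⟨$⟩ʳ_))) λ i → to (T-allᵇ-allFin p) t (π ⟨$⟩ʳ i)

-- Without function extensionality, reindexing a sum over exponent vectors needs the
-- coefficient function to respect _≗_.
Extensional : ∀ {m} → Poly m → Set
Extensional p = p Preserves _≗_ ⟶ _≡_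

var-extensional : ∀ {m} (j : Fin m) → Extensional (var j)
var-extensional {m} j α≗α′ = cong (λ b → if b then 1ℚ else 0ℚ)
  (allᵇ-cong (λ i → cong (_≡ᵇ _) (α≗α′ i)) (allFin m))

one-extensional : ∀ {m} → Extensional (one {m})
one-extensional {m} α≗α′ = cong (λ b → if b then 1ℚ else 0ℚ)
  (allᵇ-cong (λ i → cong (_≡ᵇ 0) (α≗α′ i)) (allFin m))

⊖-extensional : ∀ {m} {p q : Poly m} → Extensional p → Extensional q → Extensional (p ⊖ q)
⊖-extensional p-ext q-ext α≗α′ = cong₂ _-_ (p-ext α≗α′) (q-ext α≗α′)

⊗-extensional : ∀ {m} {p q : Poly m} → Extensional p → Extensional q → Extensional (p ⊗ q)
⊗-extensional {m} {p} {q} p-ext q-ext {α} {α′} α≗α′ = begin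
  sumℚ (map F (below m α))
    ≡⟨ sumℚ-reindex (Fin m →-setoid ℕ) F-cong (below-unique m α) (below-unique m α′)
         (below-resp α≗α′) (below-resp (λ i → sym (α≗α′ i))) ⟩
  sumℚ (map F (below m α′))
    ≡⟨ cong sumℚ (map-cong (λ β → cong (p β *_) (q-ext λ i → cong (_∸ β i) (α≗α′ i))) (below m α′)) ⟩
  sumℚ (map (λ β → p β * q (λ i → α′ i ∸ β i)) (below m α′)) ∎
  where
  open ≡-Reasoning
  F : Mon m → ℚ
  F β = p β * q (λ i → α i ∸ β i)
  F-cong : F Preserves _≗_ ⟶ _≡_
  F-cong β≗β′ = cong₂ _*_ (p-ext β≗β′) (q-ext λ i → cong (α i ∸_) (β≗β′ i))
  below-resp : ∀ {γ γ′ β} → γ ≗ γ′ → β ∈≗ below m γ → β ∈≗ below m γ′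
  below-resp {β = β} γ≗γ′ β∈ = ∈-below⁺ m λ i → subst (β i ≤_) (γ≗γ′ i) (∈-below⁻ m β∈ i)

⊗-cong : ∀ {m} {p p′ q q′ : Poly m} → p ≗ p′ → q ≗ q′ → p ⊗ q ≗ p′ ⊗ q′
⊗-cong {m} p≗p′ q≗q′ α = cong sumℚ (map-cong (λ β → cong₂ _*_ (p≗p′ β) (q≗q′ _)) (below m α))

module _ {m : ℕ} (π : Permutation′ m) where

  act-var : ∀ j → act (π ⟨$⟩ʳ_) (var j) ≗ var (π ⟨$⟩ʳ j)
  act-var j β = cong (λ b → if b then 1ℚ else 0ℚ) (begin
    allᵇ (λ i → β (π ⟨$⟩ʳ i) ≡ᵇ δ i j) (allFin m)
      ≡⟨ allᵇ-cong (λ i → cong (λ b → β (π ⟨$⟩ʳ i) ≡ᵇ (if b then 1 else 0)) (δ-invariant i)) (allFin m) ⟨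
    allᵇ (λ i → β (π ⟨$⟩ʳ i) ≡ᵇ δ (π ⟨$⟩ʳ i) (π ⟨$⟩ʳ j)) (allFin m)
      ≡⟨ allᵇ-allFin-∘ π (λ k → β k ≡ᵇ δ k (π ⟨$⟩ʳ j)) ⟩
    allᵇ (λ k → β k ≡ᵇ δ k (π ⟨$⟩ʳ j)) (allFin m) ∎)
    where
    open ≡-Reasoning
    δ : Fin m → Fin m → ℕ
    δ i j = if isYes (i ≟ᶠ j) then 1 else 0
    δ-invariant : ∀ i → isYes (π ⟨$⟩ʳ i ≟ᶠ π ⟨$⟩ʳ j) ≡ isYes (i ≟ᶠ j)
    δ-invariant i = isYes-⇔ (mk⇔ (⟨$⟩ʳ-injective π) (cong (π ⟨$⟩ʳ_))) (π ⟨$⟩ʳ i ≟ᶠ π ⟨$⟩ʳ j) (i ≟ᶠ j)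

  act-one : act (π ⟨$⟩ʳ_) one ≗ one
  act-one β = cong (λ b → if b then 1ℚ else 0ℚ) (allᵇ-allFin-∘ π (λ k → β k ≡ᵇ 0))

  act-⊗ : ∀ {p q : Poly m} → Extensional p → Extensional q →
          act (π ⟨$⟩ʳ_) (p ⊗ q) ≗ act (π ⟨$⟩ʳ_) p ⊗ act (π ⟨$⟩ʳ_) q
  act-⊗ {p} {q} p-ext q-ext α = sym (sumℚ-precompose π F-cong
    (below-unique m α) (below-unique m (α ∘ (π ⟨$⟩ʳ_))) ∘π-∈ ∘π⁻¹-∈)
    where
    F : Mon m → ℚ
    F β = p β * q (λ i → α (π ⟨$⟩ʳ i) ∸ β i)
    F-cong : F Preserves _≗_ ⟶ _≡_
    F-cong β≗β′ = cong₂ _*_ (p-ext β≗β′) (q-ext λ i → cong (α (π ⟨$⟩ʳ i) ∸_) (β≗β′ i))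
    ∘π-∈ : ∀ {β} → β ∈≗ below m α → β ∘ (π ⟨$⟩ʳ_) ∈≗ below m (α ∘ (π ⟨$⟩ʳ_))
    ∘π-∈ β∈ = ∈-below⁺ m λ i → ∈-below⁻ m β∈ (π ⟨$⟩ʳ i)
    ∘π⁻¹-∈ : ∀ {γ} → γ ∈≗ below m (α ∘ (π ⟨$⟩ʳ_)) → γ ∘ (π ⟨$⟩ˡ_) ∈≗ below m α
    ∘π⁻¹-∈ {γ} γ∈ = ∈-below⁺ m λ k →
      subst (γ (π ⟨$⟩ˡ k) ≤_) (cong α (inverseʳ π)) (∈-below⁻ m γ∈ (π ⟨$⟩ˡ k))

-- A record rather than a product, so that π can be recovered by unification.
record _↦⟨_⟩_ {m : ℕ} (p : Poly m) (π : Permutation′ m) (q : Poly m) : Set where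
  constructor _,_
  field
    extensional : Extensional p
    image       : q ≗ act (π ⟨$⟩ʳ_) p

module _ {m : ℕ} {π : Permutation′ m} where

  var-↦ : ∀ {j k} → π ⟨$⟩ʳ j ≡ k → var j ↦⟨ π ⟩ var k
  var-↦ {j} refl = var-extensional j , λ β → sym (act-var π j β)

  one-↦ : one ↦⟨ π ⟩ one
  one-↦ = one-extensional , λ β → sym (act-one π β)

  ⊖-↦ : ∀ {p p′ q q′} → p ↦⟨ π ⟩ q → p′ ↦⟨ π ⟩ q′ → (p ⊖ p′) ↦⟨ π ⟩ (q ⊖ q′)
  ⊖-↦ (p-ext , q≗) (p′-ext , q′≗) = ⊖-extensional p-ext p′-ext , λ β → cong₂ _-_ (q≗ β) (q′≗ β)

  ⊗-↦ : ∀ {p p′ q q′} → p ↦⟨ π ⟩ q → p′ ↦⟨ π ⟩ q′ → (p ⊗ p′) ↦⟨ π ⟩ (q ⊗ q′)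
  ⊗-↦ (p-ext , q≗) (p′-ext , q′≗) =
    ⊗-extensional p-ext p′-ext , λ α → trans (⊗-cong q≗ q′≗ α) (sym (act-⊗ π p-ext p′-ext α))

  prodPoly-↦ : ∀ {ps qs} → Pointwise _↦⟨ π ⟩_ ps qs → prodPoly ps ↦⟨ π ⟩ prodPoly qs
  prodPoly-↦ = Pointwise.foldr⁺ ⊗-↦ one-↦

map-pointwise : ∀ {A B : Set} {R : B → B → Set} {f g : A → B} {xs} →
                All (λ x → R (f x) (g x)) xs → Pointwise R (map f xs) (map g xs)
map-pointwise []           = []
map-pointwise (r All.∷ rs) = r ∷ map-pointwise rs

concatMap-pointwise : ∀ {A B : Set} {R : B → B → Set} {f g : A → List B} {xs} →
                      All (λ x → Pointwise R (f x) (g x)) xs →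
                      Pointwise R (concatMap f xs) (concatMap g xs)
concatMap-pointwise = Pointwise.concat⁺ ∘ map-pointwise

part-antitone : ∀ {λ′} → Linked (λ a b → b ≤ a) λ′ → ∀ {i j} → i ≤ j → part λ′ j ≤ part λ′ i
part-antitone _ {zero} {zero} _ = ≤-refl
part-antitone {[]}        _ _ = z≤n
part-antitone {_ ∷ []}    _ {j = suc _} _ = z≤n
part-antitone {_ ∷ _ ∷ _} (b≤a ∷ λ-antitone) {zero} {suc j} _ =
  ≤-trans (part-antitone λ-antitone {zero} {j} z≤n) b≤a
part-antitone {_ ∷ _ ∷ _} (_ ∷ λ-antitone) {suc i} {suc j} (s≤s i≤j) =
  part-antitone λ-antitone i≤j

module _ {m : ℕ} {λ′ : List ℕ} where
  open StandardTableau

  -- specht λ′ U is by definition prodPoly (concatMap (column U) (upTo (part λ′ 0))).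
  factor : StandardTableau m λ′ → ℕ → ℕ → ℕ → Poly m
  factor U c i′ i = if c <ᵇ part λ′ i′ then var (Q U i c) ⊖ var (Q U i′ c) else one

  column : StandardTableau m λ′ → ℕ → List (Poly m)
  column U c = concatMap (λ i′ → map (factor U c i′) (upTo i′)) (upTo (length λ′))

  module _ (λ-antitone : Linked (λ a b → b ≤ a) λ′) {π : Permutation′ m} (T T′ : StandardTableau m λ′)
           (π∘T≡T′ : ∀ r c → InDiagram λ′ r c → π ⟨$⟩ʳ Q T r c ≡ Q T′ r c) where

    factor-↦ : ∀ c i′ {i} → i < i′ → factor T c i′ i ↦⟨ π ⟩ factor T′ c i′ i
    factor-↦ c i′ {i} i<i′ with c <ᵇ part λ′ i′ | <ᵇ-reflects-< c (part λ′ i′)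
    ... | false | _          = one-↦
    ... | true  | ofʸ c<part =
      ⊖-↦ (var-↦ (π∘T≡T′ i c (<-≤-trans c<part (part-antitone λ-antitone (<⇒≤ i<i′)))))
          (var-↦ (π∘T≡T′ i′ c c<part))

    column-↦ : ∀ c → Pointwise _↦⟨ π ⟩_ (column T c) (column T′ c)
    column-↦ c = concatMap-pointwise (Allₚ.applyUpTo⁺₂ id (length λ′) λ i′ →
      map-pointwise (Allₚ.applyUpTo⁺₁ id i′ (factor-↦ c i′)))

    specht-↦ : specht λ′ T ↦⟨ π ⟩ specht λ′ T′
    specht-↦ = prodPoly-↦ (concatMap-pointwise (Allₚ.applyUpTo⁺₂ id (part λ′ 0) column-↦))

InYoungSubgroup : ∀ {m} → List ℕ → (Fin m → Fin m) → Set
InYoungSubgroup μ σ = Injective _≡_ _≡_ σ × (∀ i → ν μ (σ i) ≡ ν μ i)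

module _ {m : ℕ} (μ : List ℕ) where

  T-inYoung : ∀ {σ : Fin m → Fin m} → T (inYoung μ σ) ⇔ InYoungSubgroup μ σ
  T-inYoung {σ} = mk⇔
    (λ t → let injᵇ , rowsᵇ = to T-∧ t in
      (λ {i} {j} → to (T-implication (σ i ≟ᶠ σ j) (i ≟ᶠ j))
                     (to (T-allᵇ-allFin _) (to (T-allᵇ-allFin _) injᵇ i) j)) ,
      (λ i → ≡ᵇ⇒≡ _ _ (to (T-allᵇ-allFin _) rowsᵇ i)))
    (λ (σ-inj , σ-rows) → from T-∧
      ( from (T-allᵇ-allFin _) (λ i → from (T-allᵇ-allFin _) λ j →
          from (T-implication (σ i ≟ᶠ σ j) (i ≟ᶠ j)) σ-inj)
      , from (T-allᵇ-allFin _) (λ i → ≡⇒≡ᵇ _ _ (σ-rows i))))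
    where open Equivalence

  InYoungSubgroup-resp-≗ : ∀ {σ σ′ : Fin m → Fin m} → σ ≗ σ′ → InYoungSubgroup μ σ → InYoungSubgroup μ σ′
  InYoungSubgroup-resp-≗ σ≗σ′ (σ-inj , σ-rows) =
    (λ {i} {j} eq → σ-inj (trans (σ≗σ′ i) (trans eq (sym (σ≗σ′ j))))) ,
    (λ i → trans (cong (ν μ) (sym (σ≗σ′ i))) (σ-rows i))

  InYoungSubgroup-∘ : ∀ {σ τ : Fin m → Fin m} →
                      InYoungSubgroup μ σ → InYoungSubgroup μ τ → InYoungSubgroup μ (σ ∘ τ)
  InYoungSubgroup-∘ (σ-inj , σ-rows) (τ-inj , τ-rows) =
    τ-inj ∘ σ-inj , λ i → trans (σ-rows _) (τ-rows i)

  private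
    inYoung-resp : (T ∘ inYoung {m} μ) Respects _≗_
    inYoung-resp σ≗σ′ = Equivalence.from T-inYoung ∘ InYoungSubgroup-resp-≗ σ≗σ′ ∘ Equivalence.to T-inYoung

  ∈-youngSubgroup⁺ : ∀ {σ} → InYoungSubgroup μ σ → σ ∈≗ youngSubgroup m μ
  ∈-youngSubgroup⁺ {σ} σ∈Sμ =
    SetoidMembershipₚ.∈-filter⁺ (Fin m →-setoid Fin m) (T? ∘ inYoung μ) inYoung-resp
      (∈-allFuns m m σ) (Equivalence.from T-inYoung σ∈Sμ)

  ∈-youngSubgroup⁻ : ∀ {σ} → σ ∈≗ youngSubgroup m μ → InYoungSubgroup μ σ
  ∈-youngSubgroup⁻ σ∈ = Equivalence.to T-inYoung (proj₂
    (SetoidMembershipₚ.∈-filter⁻ (Fin m →-setoid Fin m) (T? ∘ inYoung μ) inYoung-resp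
      {xs = allFuns m m} σ∈))

  youngSubgroup-unique : Unique≗ (youngSubgroup m μ)
  youngSubgroup-unique = SetoidUniqueₚ.filter⁺ (Fin m →-setoid Fin m) (T? ∘ inYoung μ) (allFuns-unique m m)

sumPoly-map : ∀ {A : Set} {m} (h : A → Poly m) xs α → sumPoly (map h xs) α ≡ sumℚ (map (λ x → h x α) xs)
sumPoly-map h []       α = refl
sumPoly-map h (x ∷ xs) α = cong (h x α +_) (sumPoly-map h xs α)

module _ {m : ℕ} (μ : List ℕ) where
  private
    G = youngSubgroup m μ

  Y-cong : ∀ {p q : Poly m} → p ≗ q → Y μ p ≗ Y μ q
  Y-cong {p} {q} p≗q α = cong (inv (length G) *_) (begin
    sumPoly (map (λ σ → act σ p) G) α  ≡⟨ sumPoly-map (λ σ → act σ p) G α ⟩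
    sumℚ (map (λ σ → p (α ∘ σ)) G)     ≡⟨ cong sumℚ (map-cong (λ σ → p≗q (α ∘ σ)) G) ⟩
    sumℚ (map (λ σ → q (α ∘ σ)) G)     ≡⟨ sumPoly-map (λ σ → act σ q) G α ⟨
    sumPoly (map (λ σ → act σ q) G) α  ∎)
    where open ≡-Reasoning

  Y-absorbs-act : (π : Permutation′ m) → (∀ i → ν μ (π ⟨$⟩ʳ i) ≡ ν μ i) →
          ∀ {p} → Extensional p → Y μ (act (π ⟨$⟩ʳ_) p) ≗ Y μ p
  Y-absorbs-act π π-rows {p} p-ext α = cong (inv (length G) *_) (begin
    sumPoly (map (λ σ → act σ (act (π ⟨$⟩ʳ_) p)) G) α
      ≡⟨ sumPoly-map (λ σ → act σ (act (π ⟨$⟩ʳ_) p)) G α ⟩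
    sumℚ (map (λ σ → F (σ ∘ (π ⟨$⟩ʳ_))) G)
      ≡⟨ sumℚ-precompose π F-cong (youngSubgroup-unique μ) (youngSubgroup-unique μ)
           (∘-closed π∈Sμ) (∘-closed π⁻¹∈Sμ) ⟩
    sumℚ (map F G)
      ≡⟨ sumPoly-map (λ σ → act σ p) G α ⟨
    sumPoly (map (λ σ → act σ p) G) α ∎)
    where
    open ≡-Reasoning
    F : (Fin m → Fin m) → ℚ
    F σ = p (α ∘ σ)
    F-cong : F Preserves _≗_ ⟶ _≡_
    F-cong σ≗σ′ = p-ext (λ i → cong α (σ≗σ′ i))
    π∈Sμ : InYoungSubgroup μ (π ⟨$⟩ʳ_)
    π∈Sμ = ⟨$⟩ʳ-injective π , π-rows
    π⁻¹∈Sμ : InYoungSubgroup μ (π ⟨$⟩ˡ_)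
    π⁻¹∈Sμ = ⟨$⟩ʳ-injective (flip π) , λ i → trans (sym (π-rows (π ⟨$⟩ˡ i))) (cong (ν μ) (inverseʳ π))
    ∘-closed : ∀ {τ} → InYoungSubgroup μ τ → ∀ {σ} → σ ∈≗ G → σ ∘ τ ∈≗ G
    ∘-closed τ∈Sμ σ∈G = ∈-youngSubgroup⁺ μ (InYoungSubgroup-∘ μ (∈-youngSubgroup⁻ μ σ∈G) τ∈Sμ)

module _ {m : ℕ} {λ′ : List ℕ} where
  open StandardTableau

  private
    transfer : StandardTableau m λ′ → StandardTableau m λ′ → Fin m → Fin m
    transfer U U′ k = let r , c , _ = surjective U k in Q U′ r c

    transfer-Q : ∀ U U′ {r c} → InDiagram λ′ r c → transfer U U′ (Q U r c) ≡ Q U′ r c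
    transfer-Q U U′ {r} {c} box =
      let r′ , c′ , box′ , Q≡ = surjective U (Q U r c)
          r′≡r , c′≡c = injective U r′ c′ r c box′ box Q≡
      in cong₂ (Q U′) r′≡r c′≡c

    transfer-inverse : ∀ U U′ k → transfer U′ U (transfer U U′ k) ≡ k
    transfer-inverse U U′ k = let _ , _ , box , Q≡k = surjective U k in trans (transfer-Q U′ U box) Q≡k

  tableauPermutation : StandardTableau m λ′ → StandardTableau m λ′ → Permutation′ m
  tableauPermutation U U′ =
    permutation (transfer U U′) (transfer U′ U) (transfer-inverse U′ U) (transfer-inverse U U′)

  tableauPermutation-Q : ∀ U U′ {r c} → InDiagram λ′ r c →
                         tableauPermutation U U′ ⟨$⟩ʳ Q U r c ≡ Q U′ r c
  tableauPermutation-Q = transfer-Q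

  tableauPermutation-rows : ∀ μ U U′ → (∀ r c → InDiagram λ′ r c → ν μ (Q U r c) ≡ ν μ (Q U′ r c)) →
                            ∀ k → ν μ (tableauPermutation U U′ ⟨$⟩ʳ k) ≡ ν μ k
  tableauPermutation-rows μ U U′ same-rows k =
    let r , c , box , Q≡k = surjective U k in trans (sym (same-rows r c box)) (cong (ν μ) Q≡k)

mainTheorem12 : (m : ℕ) (λ′ μ : List ℕ) → IsPartition m λ′ → IsPartition m μ →
                (Q Q′ : StandardTableau m λ′) →
                (∀ r c → InDiagram λ′ r c →
                   ν μ (StandardTableau.Q Q r c) ≡ ν μ (StandardTableau.Q Q′ r c)) →
                ∀ α → Y μ (specht λ′ Q) α ≡ Y μ (specht λ′ Q′) α
mainTheorem12 m λ′ μ (_ , λ-antitone , _) _ Q Q′ same-rows α = sym (begin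
  Y μ (specht λ′ Q′) α                 ≡⟨ Y-cong μ (_↦⟨_⟩_.image Δ↦Δ′) α ⟩
  Y μ (act (τ ⟨$⟩ʳ_) (specht λ′ Q)) α  ≡⟨ Y-absorbs-act μ τ (tableauPermutation-rows μ Q Q′ same-rows)
                                               (_↦⟨_⟩_.extensional Δ↦Δ′) α ⟩
  Y μ (specht λ′ Q) α                  ∎)
  where
  open ≡-Reasoning
  τ = tableauPermutation Q Q′
  Δ↦Δ′ : specht λ′ Q ↦⟨ τ ⟩ specht λ′ Q′
  Δ↦Δ′ = specht-↦ λ-antitone Q Q′ (λ r c → tableauPermutation-Q Q Q′)
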